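{- Let $G$ be a shrubbery with a fixed orientation, and let $C\subseteq G$ be a removable cycle. Let $G'=G\setminus V(C)$ (with the induced signature and orientation). Then for every nowhere-zero watering $\phi'$ of $G'$ there exists a nowhere-zero watering $\phi$ of $G$ such that $\phi(e)=\phi'(e)$ for every $e\in E(G')$ and $\mathrm{supp}(\phi_1)=E(C)\cup\mathrm{supp}(\phi'_1)$.
   Context: Graphs are finite and may have loops and parallel edges. Each edge $e$ consists of two half-edges, each incident with an end of $e$ (a loop has both at its end); $H(v)$ is the set of half-edges at $v$, $e_h$ the edge containing $h$, and $\deg(v)=|H(v)|$. A signed graph has a signature $\sigma:E(G)\to\{\pm1\}$; a cycle or subgraph is balanced if every cycle in it has product of signs $1$, and a cycle is unbalanced otherwise. An orientation is $\tau:H(G)\to\{\pm1\}$ with $\prod_{h\in H(e)}\tau(h)=-\sigma(e)$; for $\phi:E(G)\to\Gamma$, $\partial\phi(v)=\sum_{h\in H(v)}\tau(h)\phi(e_h)$. For $X\subseteq V(G)$, $\delta(X)$ is the set of edges with exactly one end in $X$. A shrubbery is a signed graph $G$ such that: (1) $G$ has maximum degree at most $3$; (2) if $H$ is a component of $G$ in which every vertex has degree $3$, then $H\setminus e$ contains an unbalanced cycle for every $e\in E(H)$; (3) for every $X\subseteq V(G)$ with $|X|\ge2$ and $G[X]$ balanced, $|\delta(X)|+\sum_{x\in X}(3-\deg(x))>3$; (4) $G$ has no balanced cycle of length $4$. For an oriented signed graph $G$, a watering is $\phi:E(G)\to\mathbb{Z}_2\times\mathbb{Z}_3$ with $\partial\phi(v)=(0,0)$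 if $\deg(v)=3$ and $\partial\phi(v)\in\{(0,1),(0,-1)\}$ if $\deg(v)\in\{1,2\}$ (degrees taken in the graph being watered); it is nowhere-zero if it never takes value $(0,0)$; $\phi_1,\phi_2$ denote its $\mathbb{Z}_2$ and $\mathbb{Z}_3$ coordinates. $V_2(G)$ is the set of degree-$2$ vertices. A theta is a graph consisting of two vertices and three internally disjoint paths between them; it is unbalanced if it contains an unbalanced cycle. A chord of a cycle $C$ is an edge not in $E(C)$ with both ends in $V(C)$; $\mathcal{U}(C)$ is the set of chords $e$ with $C\cup e$ an unbalanced theta. A cycle $C$ is removable if $C$ is unbalanced or $|V(C)\cap V_2(G)|+|\mathcal{U}(C)|\ge2$. -}

module Defs where

open import Data.Nat using (ℕ; zero; suc; _+_; _∸_; _≤_; _<_)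
open import Data.Nat.DivMod using (_mod_)
open import Data.Fin using (Fin; toℕ) renaming (zero to fzero; suc to fsuc)
open import Data.Fin.Properties using () renaming (_≟_ to _≟F_)
open import Data.Fin.Subset using (Subset; ∣_∣)
open import Data.Vec using (lookup)
open import Data.Bool using (Bool; true; false; if_then_else_; _∧_; _xor_; not)
open import Data.Product using (Σ; _×_; _,_; ∃; proj₁)
open import Data.Sum using (_⊎_; inj₁; inj₂)
open import Data.Empty using (⊥)
open import Relation.Nullary using (¬_)
open import Relation.Nullary.Decidable using (⌊_⌋)
open import Relation.Binary.PropositionalEquality using (_≡_; _≢_)

data ℤ₂ : Set where
  0₂ 1₂ : ℤ₂

data ℤ₃ : Set where
  0₃ 1₃ 2₃ : ℤ₃   -- 2₃ = -1

_+₂_ : ℤ₂ → ℤ₂ → ℤ₂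
0₂ +₂ y = y
1₂ +₂ 0₂ = 1₂
1₂ +₂ 1₂ = 0₂

_+₃_ : ℤ₃ → ℤ₃ → ℤ₃
0₃ +₃ y = y
1₃ +₃ 0₃ = 1₃
1₃ +₃ 1₃ = 2₃
1₃ +₃ 2₃ = 0₃
2₃ +₃ 0₃ = 2₃
2₃ +₃ 1₃ = 0₃
2₃ +₃ 2₃ = 1₃

-₃_ : ℤ₃ → ℤ₃
-₃ 0₃ = 0₃
-₃ 1₃ = 2₃
-₃ 2₃ = 1₃

Γ : Set
Γ = ℤ₂ × ℤ₃

0Γ : Γ
0Γ = 0₂ , 0₃

_⊕_ : Γ → Γ → Γ
(a , b) ⊕ (c , d) = (a +₂ c) , (b +₃ d)

⊖_ : Γ → Γ
⊖ (a , b) = a , (-₃ b)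

data Sign : Set where
  plus minus : Sign

_·_ : Sign → Sign → Sign
plus · s = s
minus · plus = minus
minus · minus = plus

negS : Sign → Sign
negS plus = minus
negS minus = plus

act : Sign → Γ → Γ
act plus x = x
act minus x = ⊖ x

sumFin : (k : ℕ) → (Fin k → ℕ) → ℕ
sumFin zero f = 0
sumFin (suc k) f = f fzero + sumFin k (λ i → f (fsuc i))

sumΓ : (k : ℕ) → (Fin k → Γ) → Γ
sumΓ zero f = 0Γ
sumΓ (suc k) f = f fzero ⊕ sumΓ k (λ i → f (fsuc i))

prodS : (k : ℕ) → (Fin k → Sign) → Sign
prodS zero f = plus
prodS (suc k) f = f fzero · prodS k (λ i → f (fsuc i))

-- Vertices Fin n, edges Fin m; edge e has two half-edges (e , 0) and (e , 1);
-- end e i is the vertex incident with half-edge (e , i).  Loops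
-- (end e 0 ≡ end e 1) and parallel edges are allowed.

record SignedGraph : Set where
  field
    n   : ℕ
    m   : ℕ
    end : Fin m → Fin 2 → Fin n
    σ   : Fin m → Sign
open SignedGraph public

h0 h1 : Fin 2
h0 = fzero
h1 = fsuc fzero

module _ (G : SignedGraph) where

  IsOrientation : (Fin (m G) → Fin 2 → Sign) → Set
  IsOrientation τ = ∀ e → τ e h0 · τ e h1 ≡ negS (σ G e)

  Joins : Fin (m G) → Fin (n G) → Fin (n G) → Set
  Joins e a b = (end G e h0 ≡ a × end G e h1 ≡ b) ⊎ (end G e h0 ≡ b × end G e h1 ≡ a)

  inS : (Fin (n G) → Bool) → Fin (m G) → Bool
  inS S e = S (end G e h0) ∧ S (end G e h1)

  degIn : (Fin (n G) → Bool) → Fin (n G) → ℕ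
  degIn S v = sumFin (m G) λ e → sumFin 2 λ i →
    if ⌊ end G e i ≟F v ⌋ ∧ inS S e then 1 else 0

  allV : Fin (n G) → Bool
  allV _ = true

  deg : Fin (n G) → ℕ
  deg = degIn allV

  ∂In : (Fin (n G) → Bool) → (Fin (m G) → Fin 2 → Sign) → (Fin (m G) → Γ) → Fin (n G) → Γ
  ∂In S τ φ v = sumΓ (m G) λ e → sumΓ 2 λ i →
    if ⌊ end G e i ≟F v ⌋ ∧ inS S e then act (τ e i) (φ e) else 0Γ

  -- φ is a watering of G[S] (values of φ outside E(G[S]) are irrelevant)
  IsWateringIn : (Fin (n G) → Bool) → (Fin (m G) → Fin 2 → Sign) → (Fin (m G) → Γ) → Set
  IsWateringIn S τ φ = ∀ v → S v ≡ true →
      (degIn S v ≡ 3 → ∂In S τ φ v ≡ 0Γ)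
    × ((degIn S v ≡ 1 ⊎ degIn S v ≡ 2) →
         (∂In S τ φ v ≡ (0₂ , 1₃) ⊎ ∂In S τ φ v ≡ (0₂ , 2₃)))

  NowhereZeroIn : (Fin (n G) → Bool) → (Fin (m G) → Γ) → Set
  NowhereZeroIn S φ = ∀ e → inS S e ≡ true → φ e ≢ 0Γ

  IsWatering : (Fin (m G) → Fin 2 → Sign) → (Fin (m G) → Γ) → Set
  IsWatering = IsWateringIn allV

  NowhereZero : (Fin (m G) → Γ) → Set
  NowhereZero = NowhereZeroIn allV

  -- Cycles: v₀ e₀ v₁ e₁ … v_{k} e_{k} v₀ with distinct vertices and
  -- distinct edges, length suc k ≥ 1 (a loop is a cycle of length 1).

  next : {k : ℕ} → Fin (suc k) → Fin (suc k)
  next {k} i = suc (toℕ i) mod (suc k)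

  record Cycle : Set where
    field
      len₋₁ : ℕ
      vs    : Fin (suc len₋₁) → Fin (n G)
      es    : Fin (suc len₋₁) → Fin (m G)
      vs-inj : ∀ i j → vs i ≡ vs j → i ≡ j
      es-inj : ∀ i j → es i ≡ es j → i ≡ j
      joins  : ∀ i → Joins (es i) (vs i) (vs (next i))
  open Cycle public

  cycleLength : Cycle → ℕ
  cycleLength C = suc (len₋₁ C)

  signC : Cycle → Sign
  signC C = prodS (suc (len₋₁ C)) λ i → σ G (es C i)

  BalancedC : Cycle → Set
  BalancedC C = signC C ≡ plus

  UnbalancedC : Cycle → Set
  UnbalancedC C = signC C ≡ minus

  vInC : Cycle → Fin (n G) → Set
  vInC C v = ∃ λ i → vs C i ≡ v

  eInC : Cycle → Fin (m G) → Set
  eInC C e = ∃ λ i → es C i ≡ e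

  anyFin : (k : ℕ) → (Fin k → Bool) → Bool
  anyFin zero f = false
  anyFin (suc k) f = f fzero Data.Bool.∨ anyFin k (λ i → f (fsuc i))

  vInCᵇ : Cycle → Fin (n G) → Bool
  vInCᵇ C v = anyFin (suc (len₋₁ C)) λ i → ⌊ vs C i ≟F v ⌋

  outside : Cycle → Fin (n G) → Bool
  outside C v = not (vInCᵇ C v)

  data Reach (u : Fin (n G)) : Fin (n G) → Set where
    here : Reach u u
    step : ∀ {w x} e → Reach u w → Joins e w x → Reach u x

  BalancedInduced : Subset (n G) → Set
  BalancedInduced X = ∀ C → (∀ i → lookup X (vs C i) ≡ true) → BalancedC C

  δcount : Subset (n G) → ℕ
  δcount X = sumFin (m G) λ e →
    if lookup X (end G e h0) xor lookup X (end G e h1) then 1 else 0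

  deficit : Subset (n G) → ℕ
  deficit X = sumFin (n G) λ x → if lookup X x then 3 ∸ deg x else 0

  record IsShrubbery : Set where
    field
      maxdeg : ∀ v → deg v ≤ 3
      cubicComp : ∀ v → (∀ w → Reach v w → deg w ≡ 3) →
                  ∀ e → Reach v (end G e h0) →
                  Σ Cycle λ D → (∀ i → Reach v (vs D i)) × (∀ i → es D i ≢ e) × UnbalancedC D
      sparse : ∀ (X : Subset (n G)) → 2 ≤ ∣ X ∣ → BalancedInduced X →
               3 < δcount X + deficit X
      noBal4 : ∀ (C : Cycle) → cycleLength C ≡ 4 → ¬ BalancedC C

  -- e ∈ 𝒰(C): chord e of C such that C ∪ e is an unbalanced theta
  InU : Cycle → Fin (m G) → Set
  InU C e = (¬ eInC C e) × vInC C (end G e h0) × vInC C (end G e h1)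
          × end G e h0 ≢ end G e h1
          × Σ Cycle λ D → (∀ j → eInC C (es D j) ⊎ es D j ≡ e) × UnbalancedC D

  -- elements counted in |V(C) ∩ V₂(G)| + |𝒰(C)|:
  -- inj₁ i  stands for the vertex vs C i (counted if it has degree 2 in G),
  -- inj₂ e  stands for the edge e (counted if e ∈ 𝒰(C)).
  Counted : (C : Cycle) → Fin (cycleLength C) ⊎ Fin (m G) → Set
  Counted C (inj₁ i) = deg (vs C i) ≡ 2
  Counted C (inj₂ e) = InU C e

  Removable : Cycle → Set
  Removable C = UnbalancedC C
    ⊎ Σ (Fin (cycleLength C) ⊎ Fin (m G)) λ x → Σ (Fin (cycleLength C) ⊎ Fin (m G)) λ y →
        x ≢ y × Counted C x × Counted C y

module Submission where

-- The extension φ is (1 , x_j) on the j-th edge of C and (0 , ±1) on the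
-- other new edges, so its ℤ₂-part has support E(C) ∪ supp φ'₁ and the
-- ℤ₂-part of every boundary vanishes.  An edge from C to a vertex u of G'
-- gets the value that keeps the vertex condition at u (topUp-condition).
-- At the vertices of C the ℤ₃-conditions form a cyclic linear system
-- a_j x_j + b_{j-1} x_{j-1} = r_j, solvable when C is unbalanced and, when
-- C is balanced, as soon as a weighted sum Φ of the r_j vanishes
-- (CyclicSystem).  The two items given by removability (vertices of degree
-- 2, whose target ±1 is free, and chords in 𝒰(C), whose value ±1 is free)
-- each move Φ by a nonzero amount, and two such moves reach 0 in ℤ₃.

open import Defs
open import Algebra.Bundles using (CommutativeMonoid)
open import Algebra.Structures using (IsCommutativeMonoid)
open import Algebra.Structures.Biased using (isCommutativeMonoidˡ)
open import Data.Bool using (Bool; true; false; not; _∧_; if_then_else_)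
open import Data.Bool.Properties using (∧-zeroʳ; ∧-identityʳ)
open import Data.Fin using (Fin; zero; suc; fromℕ; inject₁; toℕ)
open import Data.Fin.Properties
  using (any?; suc-injective; toℕ-injective; toℕ-fromℕ<; toℕ-fromℕ; toℕ-inject₁; toℕ<n)
  renaming (_≟_ to _≟F_)
open import Data.List using (List; []; _∷_; cartesianProduct)
open import Data.List.Membership.Propositional using (_∈_)
open import Data.List.Membership.Propositional.Properties using (∈-cartesianProduct⁺)
open import Data.List.Relation.Unary.All as All using (all?)
open import Data.List.Relation.Unary.Any as Any using (here; there)
open import Data.Nat using (ℕ; zero; suc; _+_; _<_; _%_; s<s) renaming (_≟_ to _≟ℕ_)
open import Data.Nat.DivMod using (m<n⇒m%n≡m; n%n≡0)
open import Data.Nat.Properties using (+-0-isCommutativeMonoid; m+n≡0⇒m≡0; m+n≡0⇒n≡0)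
open import Data.Product using (Σ; ∃; _×_; _,_; proj₁; proj₂)
import Data.Product.Instances  -- decidable equality of pairs, for Γ
open import Data.Product.Properties using (≡-dec)
open import Data.Sum using (_⊎_; inj₁; inj₂)
import Data.Sum.Properties as Sum
open import Function using (_∘_)
open import Function.Bundles using (_⇔_; mk⇔)
open import Relation.Binary.PropositionalEquality
  using (_≡_; _≢_; refl; sym; trans; cong; cong₂; subst; subst₂; isEquivalence; module ≡-Reasoning)
open import Relation.Binary.PropositionalEquality.Properties using (isDecEquivalence)
open import Relation.Binary.Structures using (IsDecEquivalence)
open import Relation.Binary.TypeClasses using (_≟_)
open import Relation.Nullary using (Dec; yes; no; ¬_; ¬?)
open import Data.Empty using (⊥-elim)
open import Relation.Nullary.Decidable using (True; toWitness; _→-dec_; _×-dec_; _⊎-dec_; ⌊_⌋)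

-- A decidable property of the
-- elements of a finite type is proved by checking every element; the check
-- is carried out by evaluation while type checking.

record Finite (A : Set) : Set where
  field
    elements : List A
    complete : ∀ x → x ∈ elements
open Finite {{...}}

instance
  Bool-finite : Finite Bool
  Bool-finite = record { elements = false ∷ true ∷ [] ; complete = λ where
    false → here refl ; true → there (here refl) }

  ℤ₂-finite : Finite ℤ₂
  ℤ₂-finite = record { elements = 0₂ ∷ 1₂ ∷ [] ; complete = λ where
    0₂ → here refl ; 1₂ → there (here refl) }

  ℤ₃-finite : Finite ℤ₃
  ℤ₃-finite = record { elements = 0₃ ∷ 1₃ ∷ 2₃ ∷ [] ; complete = λ where
    0₃ → here refl ; 1₃ → there (here refl) ; 2₃ → there (there (here refl)) }

  Sign-finite : Finite Sign
  Sign-finite = record { elements = plus ∷ minus ∷ [] ; complete = λ where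
    plus → here refl ; minus → there (here refl) }

  ×-finite : {A B : Set} {{_ : Finite A}} {{_ : Finite B}} → Finite (A × B)
  ×-finite = record
    { elements = cartesianProduct elements elements
    ; complete = λ (a , b) → ∈-cartesianProduct⁺ (complete a) (complete b) }

  ℤ₂-decEq : IsDecEquivalence {A = ℤ₂} _≡_
  ℤ₂-decEq = isDecEquivalence λ where
    0₂ 0₂ → yes refl ; 0₂ 1₂ → no λ () ; 1₂ 0₂ → no λ () ; 1₂ 1₂ → yes refl

  ℤ₃-decEq : IsDecEquivalence {A = ℤ₃} _≡_
  ℤ₃-decEq = isDecEquivalence λ where
    0₃ 0₃ → yes refl ; 0₃ 1₃ → no λ () ; 0₃ 2₃ → no λ ()
    1₃ 0₃ → no λ () ; 1₃ 1₃ → yes refl ; 1₃ 2₃ → no λ ()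
    2₃ 0₃ → no λ () ; 2₃ 1₃ → no λ () ; 2₃ 2₃ → yes refl

  Sign-decEq : IsDecEquivalence {A = Sign} _≡_
  Sign-decEq = isDecEquivalence λ where
    plus plus → yes refl ; plus minus → no λ ()
    minus plus → no λ () ; minus minus → yes refl

by-exhaustion : {A : Set} {{_ : Finite A}} {P : A → Set} (P? : ∀ a → Dec (P a))
  {check : True (all? P? elements)} → ∀ a → P a
by-exhaustion P? {check} a = All.lookup (toWitness check) (complete a)

exists? : {A : Set} {{_ : Finite A}} {P : A → Set} → (∀ a → Dec (P a)) → Dec (∃ P)
exists? P? with Any.any? P? elements
... | yes p = yes (Any.satisfied p)
... | no ¬p = no λ (a , pa) → ¬p (Any.map (λ { refl → pa }) (complete a))

_-₃_ : ℤ₃ → ℤ₃ → ℤ₃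
a -₃ b = a +₃ (-₃ b)

sg : Sign → ℤ₃ → ℤ₃
sg plus v = v
sg minus v = -₃ v

toℤ₃ : Sign → ℤ₃
toℤ₃ s = sg s 1₃

-- switch α w is w when α = minus and 0 otherwise; toℤ₃ α = 1 + switch α 1
switch : Sign → ℤ₃ → ℤ₃
switch plus _ = 0₃
switch minus w = w

sg-sg : ∀ s t → sg s (sg s t) ≡ t
sg-sg s t = by-exhaustion (λ (s , t) → sg s (sg s t) ≟ t) (s , t)

sg-nonzero : ∀ s t → t ≢ 0₃ → sg s t ≢ 0₃
sg-nonzero s t = by-exhaustion (λ (s , t) → ¬? (t ≟ 0₃) →-dec ¬? (sg s t ≟ 0₃)) (s , t)

-- Any c ∈ ℤ₃ is cancelled by switching on some of two nonzero elements:
-- the four sums c, c + A, c + B, c + A + B cover ℤ₃.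
pick : ∀ c A B → A ≢ 0₃ → B ≢ 0₃ →
  Σ (Sign × Sign) λ (α , β) → (c +₃ switch α A) +₃ switch β B ≡ 0₃
pick c A B = by-exhaustion (λ (c , A , B) → ¬? (A ≟ 0₃) →-dec (¬? (B ≟ 0₃) →-dec
  exists? λ (α , β) → (c +₃ switch α A) +₃ switch β B ≟ 0₃)) (c , A , B)

≡-commutativeMonoid : {A : Set} (_∙_ : A → A → A) (ε : A) →
  (∀ x y z → (x ∙ y) ∙ z ≡ x ∙ (y ∙ z)) → (∀ x → ε ∙ x ≡ x) →
  (∀ x y → x ∙ y ≡ y ∙ x) → IsCommutativeMonoid _≡_ _∙_ ε
≡-commutativeMonoid _∙_ ε assoc idˡ comm = isCommutativeMonoidˡ record
  { isSemigroup = record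
      { isMagma = record { isEquivalence = isEquivalence ; ∙-cong = cong₂ _∙_ }
      ; assoc = assoc }
  ; identityˡ = idˡ
  ; comm = comm }

+₂-isCM : IsCommutativeMonoid _≡_ _+₂_ 0₂
+₂-isCM = ≡-commutativeMonoid _+₂_ 0₂
  (λ x y z → by-exhaustion (λ (x , y , z) → (x +₂ y) +₂ z ≟ x +₂ (y +₂ z)) (x , y , z))
  (λ _ → refl)
  (λ x y → by-exhaustion (λ (x , y) → x +₂ y ≟ y +₂ x) (x , y))

+₃-isCM : IsCommutativeMonoid _≡_ _+₃_ 0₃
+₃-isCM = ≡-commutativeMonoid _+₃_ 0₃
  (λ x y z → by-exhaustion (λ (x , y , z) → (x +₃ y) +₃ z ≟ x +₃ (y +₃ z)) (x , y , z))
  (λ _ → refl)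
  (λ x y → by-exhaustion (λ (x , y) → x +₃ y ≟ y +₃ x) (x , y))

·-isCM : IsCommutativeMonoid _≡_ _·_ plus
·-isCM = ≡-commutativeMonoid _·_ plus
  (λ x y z → by-exhaustion (λ (x , y , z) → (x · y) · z ≟ x · (y · z)) (x , y , z))
  (λ _ → refl)
  (λ x y → by-exhaustion (λ (x , y) → x · y ≟ y · x) (x , y))

⊕-isCM : IsCommutativeMonoid _≡_ _⊕_ 0Γ
⊕-isCM = ≡-commutativeMonoid _⊕_ 0Γ
  (λ (a , b) (c , d) (e , f) → cong₂ _,_ (assoc +₂-isCM a c e) (assoc +₃-isCM b d f))
  (λ _ → refl)
  (λ (a , b) (c , d) → cong₂ _,_ (comm +₂-isCM a c) (comm +₃-isCM b d))
  where open IsCommutativeMonoid using (assoc; comm)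

·-comm : ∀ s t → s · t ≡ t · s
·-comm = IsCommutativeMonoid.comm ·-isCM

-- Defs introduces sums over Fin k separately for ℕ, Γ and
-- signs; each is the right fold of a commutative monoid.  A summation
-- packages such a fold with its two defining equations, so that the
-- general facts below (and the library's facts about 'sum') apply to all.

record Summation : Set₁ where
  field
    {Carrier} : Set
    {_∙_}     : Carrier → Carrier → Carrier
    {ε}       : Carrier
    isCM      : IsCommutativeMonoid _≡_ _∙_ ε
    ∑         : (k : ℕ) → (Fin k → Carrier) → Carrier
    ∑-zero    : ∀ f → ∑ 0 f ≡ ε
    ∑-suc     : ∀ k f → ∑ (suc k) f ≡ f zero ∙ ∑ k (f ∘ suc)

-- the cyclic predecessor on Fin (suc k), inverse to next of Defs
prev : {k : ℕ} → Fin (suc k) → Fin (suc k)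
prev {k} zero = fromℕ k
prev (suc i) = inject₁ i

module FinSum (S : Summation) where
  open Summation S
  open IsCommutativeMonoid isCM using (identityˡ; identityʳ; comm)
  private
    M : CommutativeMonoid _ _
    M = record { isCommutativeMonoid = isCM }
  open import Algebra.Properties.CommutativeMonoid.Sum M
    using (sum; sum-cong-≗; ∑-distrib-+; sum-init-last)

  ∑≡sum : ∀ k (f : Fin k → Carrier) → ∑ k f ≡ sum f
  ∑≡sum zero f = ∑-zero f
  ∑≡sum (suc k) f = trans (∑-suc k f) (cong (f zero ∙_) (∑≡sum k (f ∘ suc)))

  ∑-cong : ∀ k {f g : Fin k → Carrier} → (∀ j → f j ≡ g j) → ∑ k f ≡ ∑ k g
  ∑-cong k {f} {g} f≗g = trans (∑≡sum k f) (trans (sum-cong-≗ f≗g) (sym (∑≡sum k g)))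

  ∑-∙ : ∀ k (f g : Fin k → Carrier) → ∑ k (λ j → f j ∙ g j) ≡ ∑ k f ∙ ∑ k g
  ∑-∙ k f g = trans (∑≡sum k _)
    (trans (∑-distrib-+ f g) (sym (cong₂ _∙_ (∑≡sum k f) (∑≡sum k g))))

  ∑-ε : ∀ k (f : Fin k → Carrier) → (∀ j → f j ≡ ε) → ∑ k f ≡ ε
  ∑-ε zero f _ = ∑-zero f
  ∑-ε (suc k) f f≗ε = trans (∑-suc k f)
    (trans (cong₂ _∙_ (f≗ε zero) (∑-ε k (f ∘ suc) (f≗ε ∘ suc))) (identityʳ ε))

  ∑-single : ∀ k (f : Fin k → Carrier) (p : Fin k) → (∀ j → j ≢ p → f j ≡ ε) → ∑ k f ≡ f p
  ∑-single (suc k) f zero off = trans (∑-suc k f)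
    (trans (cong (f zero ∙_) (∑-ε k (f ∘ suc) λ j → off (suc j) λ ())) (identityʳ (f zero)))
  ∑-single (suc k) f (suc p) off = trans (∑-suc k f)
    (trans (cong₂ _∙_ (off zero λ ())
                      (∑-single k (f ∘ suc) p λ j j≢p → off (suc j) (j≢p ∘ suc-injective)))
           (identityˡ (f (suc p))))

  ∑-init-last : ∀ k (f : Fin (suc k) → Carrier) → ∑ (suc k) f ≡ ∑ k (f ∘ inject₁) ∙ f (fromℕ k)
  ∑-init-last k f = trans (∑≡sum (suc k) f)
    (trans (sum-init-last f) (cong (_∙ f (fromℕ k)) (sym (∑≡sum k (f ∘ inject₁)))))

  ∑-rotate : ∀ k (f : Fin (suc k) → Carrier) → ∑ (suc k) (f ∘ prev) ≡ ∑ (suc k) f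
  ∑-rotate k f = trans (∑-suc k (f ∘ prev)) (trans (comm _ _) (sym (∑-init-last k f)))

  -- Sums over a set P of half-edges (e , i) of a graph with m edges; the
  -- boundary and the degree of Defs are sums of this form.
  ∑₂ : ∀ m → (Fin m → Fin 2 → Bool) → (Fin m → Fin 2 → Carrier) → Carrier
  ∑₂ m P w = ∑ m λ e → ∑ 2 λ i → if P e i then w e i else ε

  ∑₂-cong : ∀ m {P P' w w'} → (∀ e i → P e i ≡ P' e i) →
    (∀ e i → P e i ≡ true → w e i ≡ w' e i) → ∑₂ m P w ≡ ∑₂ m P' w'
  ∑₂-cong m {P} {P'} {w} {w'} P≗P' agree = ∑-cong m λ e → ∑-cong 2 λ i → termwise e i (P e i) refl
    where
    termwise : ∀ e i b → P e i ≡ b → (if b then w e i else ε) ≡ (if P' e i then w' e i else ε)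
    termwise e i true  Pei = trans (cong (if_then w e i else ε) (trans (sym Pei) (P≗P' e i)))
                                   (cong (if P' e i then_else ε) (agree e i Pei))
    termwise e i false Pei = cong (if_then w' e i else ε) (trans (sym Pei) (P≗P' e i))

  ∑₂-split : ∀ m (P Q : Fin m → Fin 2 → Bool) w →
    ∑₂ m P w ≡ ∑₂ m (λ e i → P e i ∧ Q e i) w ∙ ∑₂ m (λ e i → P e i ∧ not (Q e i)) w
  ∑₂-split m P Q w =
    trans (∑-cong m λ e → trans (∑-cong 2 λ i → termwise (P e i) (Q e i) (w e i)) (∑-∙ 2 (F₁ e) (F₂ e)))
          (∑-∙ m (λ e → ∑ 2 (F₁ e)) (λ e → ∑ 2 (F₂ e)))
    where
    F₁ F₂ : Fin m → Fin 2 → Carrier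
    F₁ e i = if P e i ∧ Q e i then w e i else ε
    F₂ e i = if P e i ∧ not (Q e i) then w e i else ε
    termwise : ∀ p q x → (if p then x else ε) ≡ (if p ∧ q then x else ε) ∙ (if p ∧ not q then x else ε)
    termwise true  true  x = sym (identityʳ x)
    termwise true  false x = sym (identityˡ x)
    termwise false _     x = sym (identityˡ ε)

  ∑₂-empty : ∀ m P w → (∀ e i → P e i ≡ false) → ∑₂ m P w ≡ ε
  ∑₂-empty m P w none = ∑-ε m _ λ e → ∑-ε 2 _ λ i → cong (if_then w e i else ε) (none e i)

  ∑₂-single : ∀ m P w e₀ i₀ → P e₀ i₀ ≡ true →
    (∀ e i → P e i ≡ true → e ≡ e₀ × i ≡ i₀) → ∑₂ m P w ≡ w e₀ i₀
  ∑₂-single m P w e₀ i₀ P₀ only =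
    trans (∑-single m _ e₀ λ e e≢e₀ → ∑-ε 2 _ λ i → off e i (P e i) refl (e≢e₀ ∘ proj₁))
          (trans (∑-single 2 _ i₀ λ i i≢i₀ → off e₀ i (P e₀ i) refl (i≢i₀ ∘ proj₂))
                 (cong (if_then w e₀ i₀ else ε) P₀))
    where
    off : ∀ e i b → P e i ≡ b → ¬ (e ≡ e₀ × i ≡ i₀) → (if b then w e i else ε) ≡ ε
    off e i true  Pei ne = ⊥-elim (ne (only e i Pei))
    off e i false _  _  = refl

module FinSumHom (S T : Summation) (h : Summation.Carrier S → Summation.Carrier T)
  (h-ε : h (Summation.ε S) ≡ Summation.ε T)
  (h-∙ : ∀ x y → h (Summation._∙_ S x y) ≡ Summation._∙_ T (h x) (h y)) where
  private
    module S = Summation S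
    module T = Summation T
  open FinSum S using () renaming (∑₂ to ∑₂ˢ)
  open FinSum T using () renaming (∑₂ to ∑₂ᵗ)

  ∑-hom : ∀ k (f : Fin k → S.Carrier) → h (S.∑ k f) ≡ T.∑ k (h ∘ f)
  ∑-hom zero f = trans (cong h (S.∑-zero f)) (trans h-ε (sym (T.∑-zero (h ∘ f))))
  ∑-hom (suc k) f = trans (cong h (S.∑-suc k f))
    (trans (h-∙ _ _) (trans (cong (T._∙_ (h (f zero))) (∑-hom k (f ∘ suc))) (sym (T.∑-suc k (h ∘ f)))))

  ∑₂-hom : ∀ m P w → h (∑₂ˢ m P w) ≡ ∑₂ᵗ m P (λ e i → h (w e i))
  ∑₂-hom m P w = trans (∑-hom m _) (FinSum.∑-cong T m λ e → trans (∑-hom 2 _)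
    (FinSum.∑-cong T 2 λ i → h-if (P e i)))
    where
    h-if : ∀ {x} b → h (if b then x else S.ε) ≡ (if b then h x else T.ε)
    h-if true = refl
    h-if false = h-ε

sum₃ : (k : ℕ) → (Fin k → ℤ₃) → ℤ₃
sum₃ zero f = 0₃
sum₃ (suc k) f = f zero +₃ sum₃ k (f ∘ suc)

ΣΓ Σℤ₃ Σℕ ΣSign : Summation
ΣΓ    = record { isCM = ⊕-isCM ; ∑ = sumΓ ; ∑-zero = λ _ → refl ; ∑-suc = λ _ _ → refl }
Σℤ₃   = record { isCM = +₃-isCM ; ∑ = sum₃ ; ∑-zero = λ _ → refl ; ∑-suc = λ _ _ → refl }
Σℕ    = record { isCM = +-0-isCommutativeMonoid ; ∑ = sumFin ; ∑-zero = λ _ → refl ; ∑-suc = λ _ _ → refl }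
ΣSign = record { isCM = ·-isCM ; ∑ = prodS ; ∑-zero = λ _ → refl ; ∑-suc = λ _ _ → refl }

sum₃-change : ∀ k (f g : Fin k → ℤ₃) p → (∀ j → j ≢ p → f j ≡ g j) →
  sum₃ k f ≡ sum₃ k g +₃ (f p -₃ g p)
sum₃-change k f g p off = trans (FinSum.∑-cong Σℤ₃ k λ j → split (f j , g j))
  (trans (FinSum.∑-∙ Σℤ₃ k g (λ j → f j -₃ g j))
         (cong (sum₃ k g +₃_) (FinSum.∑-single Σℤ₃ k _ p λ j j≢p →
            trans (cong (_-₃ g j) (off j j≢p)) (cancel (g j)))))
  where
  split = by-exhaustion λ (x , y) → x ≟ y +₃ (x -₃ y)
  cancel = by-exhaustion λ x → x -₃ x ≟ 0₃

module SΓ = FinSum ΣΓ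
module Sℤ₃ = FinSum Σℤ₃
module Sℕ = FinSum Σℕ
module SSign = FinSum ΣSign

module Prefix (S : Summation) where
  open Summation S
  open IsCommutativeMonoid isCM using (assoc; identityʳ)

  prefix : (k : ℕ) → Carrier → (Fin k → Carrier) → Fin (suc k) → Carrier
  prefix k       z w zero    = z
  prefix (suc k) z w (suc i) = prefix k (z ∙ w zero) (w ∘ suc) i

  prefix-step : ∀ k z w (i : Fin k) → prefix k z w (suc i) ≡ prefix k z w (inject₁ i) ∙ w i
  prefix-step (suc k) z w zero    = refl
  prefix-step (suc k) z w (suc i) = prefix-step k (z ∙ w zero) (w ∘ suc) i

  prefix-last : ∀ k z w → prefix k z w (fromℕ k) ≡ z ∙ ∑ k w
  prefix-last zero    z w = sym (trans (cong (z ∙_) (∑-zero w)) (identityʳ z))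
  prefix-last (suc k) z w = trans (prefix-last k (z ∙ w zero) (w ∘ suc))
    (trans (assoc z (w zero) _) (cong (z ∙_) (sym (∑-suc k w))))

-- Positions on a cycle of length k + 1.  Defs moves along a cycle with
-- next i = (i + 1) mod (k + 1); every position is either inject₁ i, whose
-- successor is suc i, or the last one, whose successor is 0.

data Position {k : ℕ} : Fin (suc k) → Set where
  inner : (i : Fin k) → Position (inject₁ i)
  last  : Position (fromℕ k)

position : ∀ {k} (j : Fin (suc k)) → Position j
position {zero}  zero    = last
position {suc k} zero    = inner zero
position {suc k} (suc j) with position j
... | inner i = inner (suc i)
... | last    = last

-- (next carries an unused graph argument)
module _ (G : SignedGraph) where

  next-inject₁ : ∀ {k} (i : Fin k) → next G (inject₁ i) ≡ suc i
  next-inject₁ {k} i = toℕ-injective (trans (toℕ-fromℕ< _)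
    (trans (m<n⇒m%n≡m (s<s (subst (_< k) (sym (toℕ-inject₁ i)) (toℕ<n i)))) (cong suc (toℕ-inject₁ i))))

  next-last : ∀ k → next G (fromℕ k) ≡ zero
  next-last k = toℕ-injective (trans (toℕ-fromℕ< _)
    (trans (cong (λ n → suc n % suc k) (toℕ-fromℕ k)) (n%n≡0 (suc k))))

  next-prev : ∀ {k} (j : Fin (suc k)) → next G (prev j) ≡ j
  next-prev {k} zero = next-last k
  next-prev (suc i)  = next-inject₁ i

  prev-next : ∀ {k} (j : Fin (suc k)) → prev (next G j) ≡ j
  prev-next j with position j
  ... | inner i = cong prev (next-inject₁ i)
  ... | last    = cong prev (next-last _)

-- For signs a j, b j (j ∈ Fin (k + 1)) the
-- values x j ∈ ℤ₃ on the edges of a cycle must satisfy, at every vertex j,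
--   a_j x_j + b_{j-1} x_{j-1} = r_j        (indices modulo k + 1).
-- Put σ_j = -a_j b_j and ω_j = σ_0 ⋯ σ_{j-1}.  The substitution
-- x_j = ω_j a_j y_j turns the equations j ≥ 1 into y_j = y_{j-1} + ω_j r_j,
-- so y is a prefix sum starting from an arbitrary y_0 = z, and the
-- remaining equation j = 0 becomes  z - s (z + R) = r_0  with
-- R = Σ_{j ≥ 1} ω_j r_j and s = σ_0 ⋯ σ_k.  It can be met by the choice of
-- z when s = -1, and holds for every z when s = +1 and Σ_j ω_j r_j = 0.

module CyclicSystem (k : ℕ) (a b : Fin (suc k) → Sign) where
  private
    module PSign = Prefix ΣSign
    module Pℤ₃ = Prefix Σℤ₃

  LHS : (Fin (suc k) → ℤ₃) → Fin (suc k) → ℤ₃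
  LHS x j = sg (a j) (x j) +₃ sg (b (prev j)) (x (prev j))

  σ' : Fin (suc k) → Sign
  σ' j = negS (a j · b j)

  ω : Fin (suc k) → Sign
  ω = PSign.prefix k plus (σ' ∘ inject₁)

  cycleSign : Sign
  cycleSign = prodS (suc k) σ'

  ω-step : ∀ i → ω (suc i) ≡ ω (inject₁ i) · σ' (inject₁ i)
  ω-step = PSign.prefix-step k plus (σ' ∘ inject₁)

  cycleSign-ω : cycleSign ≡ ω (fromℕ k) · σ' (fromℕ k)
  cycleSign-ω = trans (SSign.∑-init-last k σ')
    (cong (_· σ' (fromℕ k)) (sym (PSign.prefix-last k plus (σ' ∘ inject₁))))

  weighted : (Fin (suc k) → ℤ₃) → ℤ₃
  weighted r = sum₃ (suc k) λ j → sg (ω j) (r j)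

  weighted⁺ : (Fin (suc k) → ℤ₃) → ℤ₃
  weighted⁺ r = sum₃ k λ i → sg (ω (suc i)) (r (suc i))

  module Candidate (r : Fin (suc k) → ℤ₃) (z : ℤ₃) where
    y x : Fin (suc k) → ℤ₃
    y = Pℤ₃.prefix k z λ i → sg (ω (suc i)) (r (suc i))
    x j = sg (ω j · a j) (y j)

    solves-suc : ∀ i → LHS x (suc i) ≡ r (suc i)
    solves-suc i =
      trans (cong (λ v → sg (a (suc i)) (sg (ω (suc i) · a (suc i)) v) +₃ sg (b p) (x p))
                  (Pℤ₃.prefix-step k z _ i))
            (identity (ω p , a p , b p , a (suc i) , ω (suc i) , y p , r (suc i)) (ω-step i))
      where
      p = inject₁ i
      identity = by-exhaustion λ (ωp , ap , bp , aj , ωj , v , t) →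
        (ωj ≟ ωp · negS (ap · bp)) →-dec
        (sg aj (sg (ωj · aj) (v +₃ sg ωj t)) +₃ sg bp (sg (ωp · ap) v) ≟ t)

    solves-zero : LHS x zero ≡ z +₃ sg (negS cycleSign) (z +₃ weighted⁺ r)
    solves-zero =
      trans (cong (λ v → sg (a zero) (sg (a zero) z) +₃ sg (b ℓ) (sg (ω ℓ · a ℓ) v))
                  (Pℤ₃.prefix-last k z _))
      (trans (identity (a zero , a ℓ , b ℓ , ω ℓ , z , z +₃ weighted⁺ r))
             (cong (λ s → z +₃ sg (negS s) (z +₃ weighted⁺ r)) (sym cycleSign-ω)))
      where
      ℓ = fromℕ k
      identity = by-exhaustion λ (a₀ , aℓ , bℓ , ωℓ , z , v) →
        sg a₀ (sg a₀ z) +₃ sg bℓ (sg (ωℓ · aℓ) v) ≟ z +₃ sg (negS (ωℓ · negS (aℓ · bℓ))) v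

  solve : ∀ r → (cycleSign ≡ plus → weighted r ≡ 0₃) →
    Σ (Fin (suc k) → ℤ₃) λ x → ∀ j → LHS x j ≡ r j
  solve r condition = by-sign cycleSign refl
    where
    R = weighted⁺ r
    by-sign : ∀ s → cycleSign ≡ s → Σ (Fin (suc k) → ℤ₃) λ x → ∀ j → LHS x j ≡ r j
    by-sign plus  s≡ = x , λ where
        zero    → trans solves-zero (trans (cong (λ s → sg (negS s) R) s≡)
                    (cancel (r zero , R) (condition s≡)))
        (suc i) → solves-suc i
      where
      open Candidate r 0₃
      cancel = by-exhaustion λ (t , R) → (t +₃ R ≟ 0₃) →-dec (-₃ R ≟ t)
    by-sign minus s≡ = x , λ where
        zero    → trans solves-zero (trans (cong (λ s → z +₃ sg (negS s) (z +₃ R)) s≡)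
                    (halve (r zero , R)))
        (suc i) → solves-suc i
      where
      z = R -₃ r zero
      open Candidate r z
      halve = by-exhaustion λ (t , R) → (R -₃ t) +₃ ((R -₃ t) +₃ R) ≟ t

⌊⌋-true : {A : Set} (a? : Dec A) → A → ⌊ a? ⌋ ≡ true
⌊⌋-true (yes _) _ = refl
⌊⌋-true (no ¬a) a = ⊥-elim (¬a a)

⌊⌋-false : {A : Set} (a? : Dec A) → ¬ A → ⌊ a? ⌋ ≡ false
⌊⌋-false (yes a) ¬a = ⊥-elim (¬a a)
⌊⌋-false (no _)  _  = refl

⌊⌋-sound : {A : Set} (a? : Dec A) → ⌊ a? ⌋ ≡ true → A
⌊⌋-sound (yes a) _ = a

true≢false : true ≢ false
true≢false ()

plus≢minus : plus ≢ minus
plus≢minus ()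

∧-intro : ∀ {x y} → x ≡ true → y ≡ true → x ∧ y ≡ true
∧-intro refl refl = refl

∧-elim : ∀ {x y} → x ∧ y ≡ true → x ≡ true × y ≡ true
∧-elim {true} {true} _ = refl , refl

not-true : ∀ {x} → not x ≡ true → x ≡ false
not-true {false} _ = refl

not-false : ∀ {x} → not x ≡ false → x ≡ true
not-false {true} _ = refl

module GraphFacts (G : SignedGraph) where

  at : Fin (m G) → Fin 2 → Fin (n G) → Bool
  at e i v = ⌊ end G e i ≟F v ⌋

  anyFin-true : ∀ k (f : Fin k → Bool) p → f p ≡ true → anyFin G k f ≡ true
  anyFin-true (suc k) f zero    fp with f zero
  ... | true = refl
  anyFin-true (suc k) f (suc p) fp with f zero
  ... | true = refl
  ... | false = anyFin-true k (f ∘ suc) p fp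

  anyFin-witness : ∀ k (f : Fin k → Bool) → anyFin G k f ≡ true → ∃ λ p → f p ≡ true
  anyFin-witness (suc k) f h with f zero in f₀
  ... | true  = zero , f₀
  ... | false with anyFin-witness k (f ∘ suc) h
  ... | p , fp = suc p , fp

  module _ {e : Fin (m G)} {a b : Fin (n G)} where
    src tgt : Joins G e a b → Fin 2
    src (inj₁ _) = h0
    src (inj₂ _) = h1
    tgt (inj₁ _) = h1
    tgt (inj₂ _) = h0

    src-end : (p : Joins G e a b) → end G e (src p) ≡ a
    src-end (inj₁ (e₀ , _)) = e₀
    src-end (inj₂ (_ , e₁)) = e₁

    tgt-end : (p : Joins G e a b) → end G e (tgt p) ≡ b
    tgt-end (inj₁ (_ , e₁)) = e₁
    tgt-end (inj₂ (e₀ , _)) = e₀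

    src≢tgt : (p : Joins G e a b) → src p ≢ tgt p
    src≢tgt (inj₁ _) ()
    src≢tgt (inj₂ _) ()

    src-or-tgt : (p : Joins G e a b) → ∀ i → i ≡ src p ⊎ i ≡ tgt p
    src-or-tgt (inj₁ _) zero       = inj₁ refl
    src-or-tgt (inj₁ _) (suc zero) = inj₂ refl
    src-or-tgt (inj₂ _) zero       = inj₂ refl
    src-or-tgt (inj₂ _) (suc zero) = inj₁ refl

    ends-product : (p : Joins G e a b) (Ω : Fin (n G) → Sign) →
      Ω (end G e h0) · Ω (end G e h1) ≡ Ω a · Ω b
    ends-product (inj₁ (e₀ , e₁)) Ω = cong₂ _·_ (cong Ω e₀) (cong Ω e₁)
    ends-product (inj₂ (e₀ , e₁)) Ω = trans (cong₂ _·_ (cong Ω e₀) (cong Ω e₁)) (·-comm (Ω b) (Ω a))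

    orientation-product : (p : Joins G e a b) → ∀ τ → IsOrientation G τ →
      τ e (src p) · τ e (tgt p) ≡ negS (σ G e)
    orientation-product (inj₁ _) τ o = o e
    orientation-product (inj₂ _) τ o = trans (·-comm (τ e h1) (τ e h0)) (o e)

  -- A cycle on whose edges the signature is the coboundary of a function
  -- Ω on vertices is balanced: the product telescopes.
  coboundary-balanced : (Ω : Fin (n G) → Sign) (D : Cycle G) →
    (∀ j → σ G (es D j) ≡ Ω (end G (es D j) h0) · Ω (end G (es D j) h1)) → BalancedC G D
  coboundary-balanced Ω D coboundary = begin
    prodS (suc ℓ) (λ j → σ G (es D j))            ≡⟨ SSign.∑-cong (suc ℓ) σ≡ ⟩
    prodS (suc ℓ) (λ j → g j · g (next G j))      ≡⟨ SSign.∑-∙ (suc ℓ) g (g ∘ next G) ⟩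
    prodS (suc ℓ) g · prodS (suc ℓ) (g ∘ next G)  ≡⟨ cong (_· prodS (suc ℓ) (g ∘ next G)) rotated ⟩
    prodS (suc ℓ) (g ∘ next G) · prodS (suc ℓ) (g ∘ next G)
                                                  ≡⟨ square (prodS (suc ℓ) (g ∘ next G)) ⟩
    plus                                          ∎
    where
    open ≡-Reasoning
    ℓ = len₋₁ D
    g : Fin (suc ℓ) → Sign
    g j = Ω (vs D j)
    σ≡ : ∀ j → σ G (es D j) ≡ g j · g (next G j)
    σ≡ j = trans (coboundary j) (ends-product (joins D j) Ω)
    rotated : prodS (suc ℓ) g ≡ prodS (suc ℓ) (g ∘ next G)
    rotated = trans (SSign.∑-cong (suc ℓ) λ j → cong g (sym (next-prev G j))) (SSign.∑-rotate ℓ (g ∘ next G))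
    square : ∀ s → s · s ≡ plus
    square = by-exhaustion λ s → s · s ≟ plus

-- The condition imposed by a watering at a vertex of degree d with
-- boundary w: IsWateringIn G S τ φ says exactly that every vertex v of
-- G[S] satisfies VertexCondition (degIn G S v) (∂In G S τ φ v).

VertexCondition : ℕ → Γ → Set
VertexCondition d w = (d ≡ 3 → w ≡ 0Γ) × ((d ≡ 1 ⊎ d ≡ 2) → w ≡ (0₂ , 1₃) ⊎ w ≡ (0₂ , 2₃))

vertexCondition? : ∀ d w → Dec (VertexCondition d w)
vertexCondition? d w = (d ≟ℕ 3 →-dec w ≟ 0Γ)
  ×-dec ((d ≟ℕ 1 ⊎-dec d ≟ℕ 2) →-dec (w ≟ (0₂ , 1₃) ⊎-dec w ≟ (0₂ , 2₃)))

unconstrained : ∀ d w → VertexCondition (4 + d) w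
unconstrained d w = (λ ()) , λ { (inj₁ ()) ; (inj₂ ()) }

ι : ℤ₃ → Γ
ι t = (0₂ , t)

private
  ΓMonoid : CommutativeMonoid _ _
  ΓMonoid = record { isCommutativeMonoid = ⊕-isCM }
open import Algebra.Definitions.RawMonoid (CommutativeMonoid.rawMonoid ΓMonoid)
  using () renaming (_×_ to _times_)
open import Algebra.Properties.Monoid.Mult (CommutativeMonoid.monoid ΓMonoid) using (×-homo-+)

-- The value of an edge at a vertex of boundary value t ∈ ℤ₃ and degree d,
-- chosen so that adding further edges of this value keeps the vertex
-- condition: for d = 1 the boundary ±1 becomes ∓1 and then 0, for d = 2
-- the boundary ±1 becomes 0, and at a vertex of degree 0 it becomes
-- 1, -1, 0 after one, two, three edges.
nonzero : ℤ₃ → ℤ₃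
nonzero 0₃ = 1₃
nonzero t  = t

topUp : ℕ → ℤ₃ → ℤ₃
topUp 0 _ = 1₃
topUp 2 t = -₃ nonzero t
topUp _ t = nonzero t

topUp-nonzero : ∀ d t → topUp d t ≢ 0₃
topUp-nonzero 0 t ()
topUp-nonzero 1 t = by-exhaustion (λ t → ¬? (topUp 1 t ≟ 0₃)) t
topUp-nonzero 2 t = by-exhaustion (λ t → ¬? (topUp 2 t ≟ 0₃)) t
topUp-nonzero (suc (suc (suc d))) t = by-exhaustion (λ t → ¬? (nonzero t ≟ 0₃)) t

-- For d + r ≥ 4 there is nothing to show;
-- the finitely many other cases are checked on every w.
TopUp : ℕ → ℕ → Γ → Set
TopUp d r w = (d ≡ 0 → w ≡ 0Γ) → VertexCondition d w →
  VertexCondition (d + r) (w ⊕ (r times ι (topUp d (proj₂ w))))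

topUp? : ∀ d r w → Dec (TopUp d r w)
topUp? d r w = (d ≟ℕ 0 →-dec w ≟ 0Γ) →-dec (vertexCondition? d w →-dec
  vertexCondition? (d + r) (w ⊕ (r times ι (topUp d (proj₂ w)))))

topUp-condition : ∀ d r w → TopUp d r w
topUp-condition 0 0 = by-exhaustion (topUp? 0 0)
topUp-condition 0 1 = by-exhaustion (topUp? 0 1)
topUp-condition 0 2 = by-exhaustion (topUp? 0 2)
topUp-condition 0 3 = by-exhaustion (topUp? 0 3)
topUp-condition 1 0 = by-exhaustion (topUp? 1 0)
topUp-condition 1 1 = by-exhaustion (topUp? 1 1)
topUp-condition 1 2 = by-exhaustion (topUp? 1 2)
topUp-condition 2 0 = by-exhaustion (topUp? 2 0)
topUp-condition 2 1 = by-exhaustion (topUp? 2 1)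
topUp-condition 3 0 = by-exhaustion (topUp? 3 0)
topUp-condition 0 (suc (suc (suc (suc r)))) w _ _ = unconstrained r _
topUp-condition 1 (suc (suc (suc r)))       w _ _ = unconstrained r _
topUp-condition 2 (suc (suc r))             w _ _ = unconstrained r _
topUp-condition 3 (suc r)                   w _ _ = unconstrained r _
topUp-condition (suc (suc (suc (suc d)))) r w _ _ = unconstrained (d + r) _

target : ℕ → Sign → ℤ₃
target 3 _ = 0₃
target _ α = toℤ₃ α

target-condition : ∀ d α → VertexCondition d (ι (target d α))
target-condition 0 α = (λ ()) , λ { (inj₁ ()) ; (inj₂ ()) }
target-condition 1 α = by-exhaustion (λ α → vertexCondition? 1 (ι (target 1 α))) α
target-condition 2 α = by-exhaustion (λ α → vertexCondition? 2 (ι (target 2 α))) α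
target-condition 3 α = (λ _ → refl) , λ { (inj₁ ()) ; (inj₂ ()) }
target-condition (suc (suc (suc (suc d)))) α = unconstrained d _

sumFin-zero : ∀ k (f : Fin k → ℕ) → sumFin k f ≡ 0 → ∀ j → f j ≡ 0
sumFin-zero (suc k) f h zero    = m+n≡0⇒m≡0 (f zero) h
sumFin-zero (suc k) f h (suc j) = sumFin-zero k (f ∘ suc) (m+n≡0⇒n≡0 (f zero) h) j

count-zero : ∀ m (P : Fin m → Fin 2 → Bool) → Sℕ.∑₂ m P (λ _ _ → 1) ≡ 0 → ∀ e i → P e i ≡ false
count-zero m P h e i =
  one≡0⇒false (P e i) (sumFin-zero 2 (count e) (sumFin-zero m (λ e → sumFin 2 (count e)) h e) i)
  where
  count : Fin m → Fin 2 → ℕ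
  count e i = if P e i then 1 else 0
  one≡0⇒false : ∀ b → (if b then 1 else 0) ≡ 0 → b ≡ false
  one≡0⇒false false _ = refl

isolated-boundary : ∀ G S τ φ v → degIn G S v ≡ 0 → ∂In G S τ φ v ≡ 0Γ
isolated-boundary G S τ φ v d≡0 = SΓ.∑₂-empty (m G) P (λ e i → act (τ e i) (φ e)) (count-zero (m G) P d≡0)
  where
  P : Fin (m G) → Fin 2 → Bool
  P e i = ⌊ end G e i ≟F v ⌋ ∧ inS G S e

count-times : ∀ m P g → SΓ.∑₂ m P (λ _ _ → g) ≡ Sℕ.∑₂ m P (λ _ _ → 1) times g
count-times m P g = sym (trans (∑₂-hom m P (λ _ _ → 1))
  (SΓ.∑₂-cong m {P} {P} (λ _ _ → refl) λ _ _ _ → IsCommutativeMonoid.identityʳ ⊕-isCM g))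
  where open FinSumHom Σℕ ΣΓ (_times g) refl (λ p q → ×-homo-+ g p q)

module Sι = FinSumHom Σℤ₃ ΣΓ ι refl (λ _ _ → refl)

act-ι : ∀ s t → act s (ι t) ≡ ι (sg s t)
act-ι plus  t = refl
act-ι minus t = refl

act-1 : ∀ s t → act s (1₂ , t) ≡ (1₂ , sg s t)
act-1 plus  t = refl
act-1 minus t = refl

-- All vertices of G' then satisfy their condition; a vertex of C does so
-- as soon as x solves the cyclic system of CyclicSystem whose right-hand
-- side is the prescribed target minus the contribution D of the edges
-- that are not in C.

module Construction (G : SignedGraph) (τ : Fin (m G) → Fin 2 → Sign) (isO : IsOrientation G τ)
  (C : Cycle G) (φ' : Fin (m G) → Γ)
  (wφ' : IsWateringIn G (outside G C) τ φ') (nzφ' : NowhereZeroIn G (outside G C) φ') where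

  open GraphFacts G

  k : ℕ
  k = len₋₁ C

  s t : Fin (suc k) → Fin 2
  s j = src (joins C j)
  t j = tgt (joins C j)

  a b : Fin (suc k) → Sign
  a j = τ (es C j) (s j)
  b j = τ (es C j) (t j)

  open CyclicSystem k a b public

  σ-cycle : ∀ j → σ G (es C j) ≡ σ' j
  σ-cycle j = flip (a j · b j , σ G (es C j)) (orientation-product (joins C j) τ isO)
    where flip = by-exhaustion λ (x , y) → (x ≟ negS y) →-dec (y ≟ negS x)

  signC≡cycleSign : signC G C ≡ cycleSign
  signC≡cycleSign = SSign.∑-cong (suc k) σ-cycle

  out : Fin (n G) → Bool
  out = outside G C

  inG' : Fin (m G) → Bool
  inG' = inS G out

  eInC? : ∀ e → Dec (eInC G C e)
  eInC? e = any? λ l → es C l ≟F e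

  isC : Fin (m G) → Bool
  isC e = ⌊ eInC? e ⌋

  out-vs : ∀ j → out (vs C j) ≡ false
  out-vs j = cong not
    (anyFin-true (suc k) (λ i → ⌊ vs C i ≟F vs C j ⌋) j (⌊⌋-true (vs C j ≟F vs C j) refl))

  on-C : ∀ u → out u ≡ false → ∃ λ j → vs C j ≡ u
  on-C u o with anyFin-witness (suc k) (λ j → ⌊ vs C j ≟F u ⌋) (not-false o)
  ... | j , q = j , ⌊⌋-sound _ q

  end-cycle : ∀ l i → ∃ λ j → end G (es C l) i ≡ vs C j
  end-cycle l i with src-or-tgt (joins C l) i
  ... | inj₁ refl = l , src-end (joins C l)
  ... | inj₂ refl = next G l , tgt-end (joins C l)

  off-C : ∀ e i → out (end G e i) ≡ true → ¬ eInC G C e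
  off-C e i o (l , refl) with end-cycle l i
  ... | j , q with trans (sym o) (trans (cong out q) (out-vs j))
  ... | ()

  off-G' : ∀ e i → out (end G e i) ≡ false → inG' e ≡ false
  off-G' e zero       o = cong (_∧ out (end G e h1)) o
  off-G' e (suc zero) o = trans (cong (out (end G e h0) ∧_) o) (∧-zeroʳ _)

  d' : Fin (n G) → ℕ
  d' = degIn G out

  ∂' : Fin (n G) → Γ
  ∂' = ∂In G out τ φ'

  c : Fin (n G) → ℤ₃
  c u = topUp (d' u) (proj₂ (∂' u))

  ψ : (Fin (m G) → Sign) → Fin (m G) → ℤ₃
  ψ χ e = if out (end G e h0) then sg (τ e h0) (c (end G e h0))
          else if out (end G e h1) then sg (τ e h1) (c (end G e h1))
          else toℤ₃ (χ e)

  φ : (Fin (suc k) → ℤ₃) → (Fin (m G) → Sign) → Fin (m G) → Γ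
  φ x χ e with eInC? e
  ... | yes (l , _) = (1₂ , x l)
  ... | no _        = if inG' e then φ' e else ι (ψ χ e)

  φ-cycle : ∀ x χ l → φ x χ (es C l) ≡ (1₂ , x l)
  φ-cycle x χ l with eInC? (es C l)
  ... | yes (l' , q) = cong (λ j → (1₂ , x j)) (es-inj C l' l q)
  ... | no ∉        = ⊥-elim (∉ (l , refl))

  φ-off : ∀ x χ e → ¬ eInC G C e → φ x χ e ≡ (if inG' e then φ' e else ι (ψ χ e))
  φ-off x χ e ∉ with eInC? e
  ... | yes ∈ = ⊥-elim (∉ ∈)
  ... | no _  = refl

  ψ-toward : ∀ χ e i → out (end G e i) ≡ true → inG' e ≡ false → ψ χ e ≡ sg (τ e i) (c (end G e i))
  ψ-toward χ e zero       o _ rewrite o = refl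
  ψ-toward χ e (suc zero) o g with out (end G e h0)
  ... | true  = ⊥-elim (true≢false (trans (sym o) g))
  ... | false rewrite o = refl

  -- the value of φ x χ read at the half-edge (e , i), and the half-edges
  -- at a vertex as they appear in ∂In G (allV G) and deg G
  seen : (Fin (suc k) → ℤ₃) → (Fin (m G) → Sign) → Fin (m G) → Fin 2 → Γ
  seen x χ e i = act (τ e i) (φ x χ e)

  around : Fin (n G) → Fin (m G) → Fin 2 → Bool
  around v e i = at e i v ∧ true

  around-end : ∀ {v e i} → around v e i ≡ true → end G e i ≡ v
  around-end {v} {e} {i} h = ⌊⌋-sound (end G e i ≟F v) (trans (sym (∧-identityʳ _)) h)

  around-∧ : ∀ v (Q : Fin (m G) → Bool) e i → around v e i ∧ Q e ≡ at e i v ∧ Q e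
  around-∧ v Q e i = cong (_∧ Q e) (∧-identityʳ (at e i v))

  extra : Fin (n G) → ℕ
  extra u = Sℕ.∑₂ (m G) (λ e i → at e i u ∧ not (inG' e)) (λ _ _ → 1)

  degree-outside : ∀ u → deg G u ≡ d' u + extra u
  degree-outside u = trans (Sℕ.∑₂-split (m G) (around u) (λ e _ → inG' e) one)
    (cong₂ _+_ (Sℕ.∑₂-cong (m G) {w = one} (around-∧ u inG') λ _ _ _ → refl)
               (Sℕ.∑₂-cong (m G) {w = one} (around-∧ u (not ∘ inG')) λ _ _ _ → refl))
    where
    one : Fin (m G) → Fin 2 → ℕ
    one _ _ = 1

  from-G' : ∀ x χ u → out u ≡ true → SΓ.∑₂ (m G) (λ e i → around u e i ∧ inG' e) (seen x χ) ≡ ∂' u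
  from-G' x χ u o = SΓ.∑₂-cong (m G) (around-∧ u inG') term
    where
    term : ∀ e i → around u e i ∧ inG' e ≡ true → seen x χ e i ≡ act (τ e i) (φ' e)
    term e i h with ∧-elim {around u e i} h
    ... | p , g = cong (act (τ e i)) (trans (φ-off x χ e (off-C e i (trans (cong out (around-end p)) o)))
                                            (cong (if_then φ' e else ι (ψ χ e)) g))

  from-C : ∀ x χ u → out u ≡ true →
    SΓ.∑₂ (m G) (λ e i → around u e i ∧ not (inG' e)) (seen x χ) ≡ extra u times ι (c u)
  from-C x χ u o = trans (SΓ.∑₂-cong (m G) (around-∧ u (not ∘ inG')) term)
                         (count-times (m G) (λ e i → at e i u ∧ not (inG' e)) (ι (c u)))
    where
    term : ∀ e i → around u e i ∧ not (inG' e) ≡ true → seen x χ e i ≡ ι (c u)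
    term e i h with ∧-elim {around u e i} h
    ... | p , g' = begin
      act (τ e i) (φ x χ e)                         ≡⟨ cong (act (τ e i)) (trans (φ-off x χ e (off-C e i oe))
                                                          (cong (if_then φ' e else ι (ψ χ e)) g)) ⟩
      act (τ e i) (ι (ψ χ e))                       ≡⟨ act-ι (τ e i) (ψ χ e) ⟩
      ι (sg (τ e i) (ψ χ e))                        ≡⟨ cong (ι ∘ sg (τ e i)) (ψ-toward χ e i oe g) ⟩
      ι (sg (τ e i) (sg (τ e i) (c (end G e i))))   ≡⟨ cong ι (sg-sg (τ e i) _) ⟩
      ι (c (end G e i))                             ≡⟨ cong (ι ∘ c) (around-end p) ⟩
      ι (c u)                                       ∎
      where
      open ≡-Reasoning
      oe = trans (cong out (around-end p)) o
      g = not-true g'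

  boundary-outside : ∀ x χ u → out u ≡ true →
    ∂In G (allV G) τ (φ x χ) u ≡ ∂' u ⊕ (extra u times ι (c u))
  boundary-outside x χ u o = trans (SΓ.∑₂-split (m G) (around u) (λ e _ → inG' e) (seen x χ))
    (cong₂ _⊕_ (from-G' x χ u o) (from-C x χ u o))

  condition-outside : ∀ x χ u → out u ≡ true → VertexCondition (deg G u) (∂In G (allV G) τ (φ x χ) u)
  condition-outside x χ u o = subst₂ VertexCondition (sym (degree-outside u)) (sym (boundary-outside x χ u o))
    (topUp-condition (d' u) (extra u) (∂' u) (isolated-boundary G out τ φ' u) (wφ' u o))

  D : (Fin (m G) → Sign) → Fin (suc k) → ℤ₃
  D χ j = Sℤ₃.∑₂ (m G) (λ e i → at e i (vs C j) ∧ not (isC e)) (λ e i → sg (τ e i) (ψ χ e))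

  cycle-half-edges : ∀ j e i → end G e i ≡ vs C j → isC e ≡ true →
    (e ≡ es C j × i ≡ s j) ⊎ (e ≡ es C (prev j) × i ≡ t (prev j))
  cycle-half-edges j e i end≡ e∈C with ⌊⌋-sound (eInC? e) e∈C
  ... | l , refl with src-or-tgt (joins C l) i
  ...   | inj₁ refl = inj₁ (cong (es C) l≡j , cong s l≡j)
    where l≡j = vs-inj C l j (trans (sym (src-end (joins C l))) end≡)
  ...   | inj₂ refl = inj₂ (cong (es C) l≡prev , cong t l≡prev)
    where l≡prev = trans (sym (prev-next G l)) (cong prev (vs-inj C _ j (trans (sym (tgt-end (joins C l))) end≡)))

  onC leaving : Fin (suc k) → Fin (m G) → Fin 2 → Bool
  onC j e i = around (vs C j) e i ∧ isC e
  leaving j e i = ⌊ ≡-dec _≟F_ _≟F_ (e , i) (es C j , s j) ⌋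

  leaving-self : ∀ j → leaving j (es C j) (s j) ≡ true
  leaving-self j = ⌊⌋-true (≡-dec _≟F_ _≟F_ (es C j , s j) (es C j , s j)) refl

  cycle-leaving : ∀ x χ j →
    SΓ.∑₂ (m G) (λ e i → onC j e i ∧ leaving j e i) (seen x χ) ≡ (1₂ , sg (a j) (x j))
  cycle-leaving x χ j = trans
    (SΓ.∑₂-single (m G) (λ e i → onC j e i ∧ leaving j e i) (seen x χ) (es C j) (s j)
      (∧-intro (∧-intro (∧-intro (⌊⌋-true (end G (es C j) (s j) ≟F vs C j) (src-end (joins C j))) refl)
                        (⌊⌋-true (eInC? (es C j)) (j , refl)))
               (leaving-self j))
      only)
    (trans (cong (act (a j)) (φ-cycle x χ j)) (act-1 (a j) (x j)))
    where
    unpair : ∀ {e i} → (e , i) ≡ (es C j , s j) → e ≡ es C j × i ≡ s j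
    unpair refl = refl , refl
    only : ∀ e i → onC j e i ∧ leaving j e i ≡ true → e ≡ es C j × i ≡ s j
    only e i h = unpair (⌊⌋-sound (≡-dec _≟F_ _≟F_ (e , i) (es C j , s j)) (proj₂ (∧-elim {onC j e i} h)))

  cycle-entering : ∀ x χ j →
    SΓ.∑₂ (m G) (λ e i → onC j e i ∧ not (leaving j e i)) (seen x χ) ≡ (1₂ , sg (b (prev j)) (x (prev j)))
  cycle-entering x χ j = trans
    (SΓ.∑₂-single (m G) (λ e i → onC j e i ∧ not (leaving j e i)) (seen x χ) (es C (prev j)) (t (prev j))
      (∧-intro (∧-intro (∧-intro (⌊⌋-true (end G (es C (prev j)) (t (prev j)) ≟F vs C j) enters) refl)
                        (⌊⌋-true (eInC? (es C (prev j))) (prev j , refl)))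
               (cong not (⌊⌋-false (≡-dec _≟F_ _≟F_ (es C (prev j) , t (prev j)) (es C j , s j)) distinct)))
      only)
    (trans (cong (act (b (prev j))) (φ-cycle x χ (prev j))) (act-1 (b (prev j)) (x (prev j))))
    where
    enters : end G (es C (prev j)) (t (prev j)) ≡ vs C j
    enters = trans (tgt-end (joins C (prev j))) (cong (vs C) (next-prev G j))
    distinct : (es C (prev j) , t (prev j)) ≢ (es C j , s j)
    distinct q with es-inj C _ _ (cong proj₁ q)
    ... | pj≡j = src≢tgt (joins C j) (sym (trans (cong t (sym pj≡j)) (cong proj₂ q)))
    only : ∀ e i → onC j e i ∧ not (leaving j e i) ≡ true → e ≡ es C (prev j) × i ≡ t (prev j)
    only e i h with ∧-elim {onC j e i} h
    ... | at-C , not-leaving with ∧-elim {around (vs C j) e i} at-C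
    ... | p , e∈C with cycle-half-edges j e i (around-end p) e∈C
    ... | inj₂ q = q
    ... | inj₁ (refl , refl) = ⊥-elim (true≢false (trans (sym (leaving-self j)) (not-true not-leaving)))

  from-others : ∀ x χ j →
    SΓ.∑₂ (m G) (λ e i → around (vs C j) e i ∧ not (isC e)) (seen x χ) ≡ ι (D χ j)
  from-others x χ j = trans (SΓ.∑₂-cong (m G) (around-∧ (vs C j) (not ∘ isC)) term)
    (sym (Sι.∑₂-hom (m G) (λ e i → at e i (vs C j) ∧ not (isC e)) (λ e i → sg (τ e i) (ψ χ e))))
    where
    term : ∀ e i → around (vs C j) e i ∧ not (isC e) ≡ true → seen x χ e i ≡ ι (sg (τ e i) (ψ χ e))
    term e i h with ∧-elim {around (vs C j) e i} h
    ... | p , e∉C = trans (cong (act (τ e i)) (trans (φ-off x χ e e∉C')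
                            (cong (if_then φ' e else ι (ψ χ e)) (off-G' e i out-end))))
                          (act-ι (τ e i) (ψ χ e))
      where
      e∉C' = λ e∈C → true≢false (trans (sym (⌊⌋-true (eInC? e) e∈C)) (not-true e∉C))
      out-end = trans (cong out (around-end p)) (out-vs j)

  boundary-cycle : ∀ x χ j → ∂In G (allV G) τ (φ x χ) (vs C j) ≡ ι (LHS x j +₃ D χ j)
  boundary-cycle x χ j =
    trans (SΓ.∑₂-split (m G) (around (vs C j)) (λ e _ → isC e) (seen x χ))
          (cong₂ _⊕_ (trans (SΓ.∑₂-split (m G) (onC j) (leaving j) (seen x χ))
                            (cong₂ _⊕_ (cycle-leaving x χ j) (cycle-entering x χ j)))
                     (from-others x χ j))

  rhs : (Fin (suc k) → Sign) → (Fin (m G) → Sign) → Fin (suc k) → ℤ₃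
  rhs ε χ j = target (deg G (vs C j)) (ε j) -₃ D χ j

  condition-cycle : ∀ ε χ x → (∀ j → LHS x j ≡ rhs ε χ j) →
    ∀ j → VertexCondition (deg G (vs C j)) (∂In G (allV G) τ (φ x χ) (vs C j))
  condition-cycle ε χ x solves j = subst (VertexCondition (deg G (vs C j))) (sym ∂≡)
    (target-condition (deg G (vs C j)) (ε j))
    where
    sub-add = λ T D → by-exhaustion (λ (T , D) → (T -₃ D) +₃ D ≟ T) (T , D)
    ∂≡ : ∂In G (allV G) τ (φ x χ) (vs C j) ≡ ι (target (deg G (vs C j)) (ε j))
    ∂≡ = trans (boundary-cycle x χ j) (cong ι (trans (cong (_+₃ D χ j) (solves j)) (sub-add _ (D χ j))))

  Extension : (Fin (m G) → Γ) → Set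
  Extension φ = IsWatering G τ φ × NowhereZero G φ × (∀ e → inG' e ≡ true → φ e ≡ φ' e)
    × (∀ e → (proj₁ (φ e) ≢ 0₂) ⇔ (eInC G C e ⊎ (inG' e ≡ true × proj₁ (φ' e) ≢ 0₂)))

  ψ-nonzero : ∀ χ e → ψ χ e ≢ 0₃
  ψ-nonzero χ e with out (end G e h0) | out (end G e h1)
  ... | true  | _     = sg-nonzero (τ e h0) (c (end G e h0)) (topUp-nonzero (d' (end G e h0)) _)
  ... | false | true  = sg-nonzero (τ e h1) (c (end G e h1)) (topUp-nonzero (d' (end G e h1)) _)
  ... | false | false = sg-nonzero (χ e) 1₃ λ ()

  agrees : ∀ x χ e → inG' e ≡ true → φ x χ e ≡ φ' e
  agrees x χ e g = trans (φ-off x χ e (off-C e h0 (proj₁ (∧-elim g)))) (cong (if_then φ' e else ι (ψ χ e)) g)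

  extension : ∀ ε χ x → (∀ j → LHS x j ≡ rhs ε χ j) → Extension (φ x χ)
  extension ε χ x solves = watering , nowhere-zero , agrees x χ , λ e → mk⇔ (to e) (from e)
    where
    watering : IsWatering G τ (φ x χ)
    watering v _ with out v in o
    ... | true  = condition-outside x χ v o
    ... | false with on-C v o
    ... | j , refl = condition-cycle ε χ x solves j
    nowhere-zero : NowhereZero G (φ x χ)
    nowhere-zero e _ with eInC? e
    ... | yes _ = λ ()
    ... | no _ with inG' e in g
    ... | true  = nzφ' e g
    ... | false = ψ-nonzero χ e ∘ cong proj₂
    to : ∀ e → proj₁ (φ x χ e) ≢ 0₂ → eInC G C e ⊎ (inG' e ≡ true × proj₁ (φ' e) ≢ 0₂)
    to e nz with eInC? e
    ... | yes e∈C = inj₁ e∈C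
    ... | no _ with inG' e
    ... | true  = inj₂ (refl , nz)
    ... | false = ⊥-elim (nz refl)
    from : ∀ e → eInC G C e ⊎ (inG' e ≡ true × proj₁ (φ' e) ≢ 0₂) → proj₁ (φ x χ e) ≢ 0₂
    from e (inj₁ (l , refl)) z with trans (sym (cong proj₁ (φ-cycle x χ l))) z
    ... | ()
    from e (inj₂ (g , nz)) z = nz (trans (sym (cong proj₁ (agrees x χ e g))) z)

  -- When C is balanced the cyclic system is solvable only if the
  -- weighted right-hand side vanishes.  The targets at degree-2 vertices of
  -- C and the values on chords of C are free; an item is a vertex of C or
  -- an edge, and a choice assigns a sign to each item.
  Item : Set
  Item = Fin (suc k) ⊎ Fin (m G)

  Φ : (Item → Sign) → ℤ₃
  Φ S = weighted (rhs (S ∘ inj₁) (S ∘ inj₂))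

  ψ-cong : ∀ {χ χ'} e → χ' e ≡ χ e → ψ χ' e ≡ ψ χ e
  ψ-cong e h with out (end G e h0) | out (end G e h1)
  ... | true  | _     = refl
  ... | false | true  = refl
  ... | false | false = cong toℤ₃ h

  D-cong : ∀ {χ χ'} → (∀ e → χ' e ≡ χ e) → ∀ j → D χ' j ≡ D χ j
  D-cong {χ} {χ'} h j = Sℤ₃.∑₂-cong (m G) {P = λ e i → at e i (vs C j) ∧ not (isC e)}
    {w = λ e i → sg (τ e i) (ψ χ' e)} (λ _ _ → refl)
    λ e i _ → cong (sg (τ e i)) (ψ-cong {χ} {χ'} e (h e))

  Update : Item → (Item → Sign) → (Item → Sign) → Set
  Update z S S' = (∀ y → y ≢ z → S' y ≡ S y) × S z ≡ plus

  update : Item → Sign → (Item → Sign) → Item → Sign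
  update z α S y = if ⌊ Sum.≡-dec _≟F_ _≟F_ y z ⌋ then α else S y

  update-at : ∀ z α S → update z α S z ≡ α
  update-at z α S = cong (if_then α else S z) (⌊⌋-true (Sum.≡-dec _≟F_ _≟F_ z z) refl)

  update-off : ∀ z α S y → y ≢ z → update z α S y ≡ S y
  update-off z α S y y≢z = cong (if_then α else S y) (⌊⌋-false (Sum.≡-dec _≟F_ _≟F_ y z) y≢z)

  updates : ∀ z α S → S z ≡ plus → Update z S (update z α S)
  updates z α S Sz = update-off z α S , Sz

  change-vertex : ∀ i → deg G (vs C i) ≡ 2 → ∀ S S' → Update (inj₁ i) S S' →
    Φ S' ≡ Φ S +₃ switch (S' (inj₁ i)) (toℤ₃ (ω i))
  change-vertex i deg≡2 S S' (same , plus-at-i) =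
    trans (sum₃-change (suc k) _ _ i off) (cong (Φ S +₃_) (trans at-i (difference (ω i , α , D χ' i))))
    where
    χ χ' : Fin (m G) → Sign
    χ = S ∘ inj₂
    χ' = S' ∘ inj₂
    α = S' (inj₁ i)
    D≡ = D-cong {χ} {χ'} λ e → same (inj₂ e) λ ()
    target-2 : ∀ α → target (deg G (vs C i)) α ≡ toℤ₃ α
    target-2 α = cong (λ d → target d α) deg≡2
    at-i : sg (ω i) (rhs (S' ∘ inj₁) χ' i) -₃ sg (ω i) (rhs (S ∘ inj₁) χ i)
         ≡ sg (ω i) (toℤ₃ α -₃ D χ' i) -₃ sg (ω i) (1₃ -₃ D χ' i)
    at-i = cong₂ (λ T' T → sg (ω i) T' -₃ sg (ω i) T)
                 (cong (_-₃ D χ' i) (target-2 α))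
                 (cong₂ _-₃_ (trans (target-2 (S (inj₁ i))) (cong toℤ₃ plus-at-i)) (sym (D≡ i)))
    off : ∀ j → j ≢ i → sg (ω j) (rhs (S' ∘ inj₁) χ' j) ≡ sg (ω j) (rhs (S ∘ inj₁) χ j)
    off j j≢i = cong₂ (λ α d → sg (ω j) (target (deg G (vs C j)) α -₃ d))
                      (same (inj₁ j) λ { refl → j≢i refl }) (D≡ j)
    difference = by-exhaustion λ (w , α , d) →
      sg w (toℤ₃ α -₃ d) -₃ sg w (1₃ -₃ d) ≟ switch α (toℤ₃ w)

  module ChordChange (e₀ : Fin (m G)) (e₀∉C : ¬ eInC G C e₀) (u v : Fin (suc k))
    (pu : vs C u ≡ end G e₀ h0) (pv : vs C v ≡ end G e₀ h1) where

    chordWeight : ℤ₃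
    chordWeight = -₃ (toℤ₃ (ω u · τ e₀ h0) +₃ toℤ₃ (ω v · τ e₀ h1))

    term : (Fin (m G) → Sign) → Fin (suc k) → Fin (m G) → ℤ₃
    term χ j e = sum₃ 2 λ i → if at e i (vs C j) ∧ not (isC e) then sg (τ e i) (ψ χ e) else 0₃

    at-e₀ : Fin (suc k) → Fin 2 → ℤ₃ → ℤ₃
    at-e₀ j i y = if at e₀ i (vs C j) ∧ true then sg (τ e₀ i) y else 0₃

    out-end : ∀ w i → vs C w ≡ end G e₀ i → out (end G e₀ i) ≡ false
    out-end w i pw = trans (cong out (sym pw)) (out-vs w)

    -- both ends of e₀ are on C, so its value is given by the choice
    ψ-chord : ∀ χ → ψ χ e₀ ≡ toℤ₃ (χ e₀)
    ψ-chord χ rewrite out-end u h0 pu | out-end v h1 pv = refl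

    contribution : Fin (suc k) → ℤ₃ → ℤ₃
    contribution j y = sum₃ 2 λ i → at-e₀ j i y

    term-e₀ : ∀ χ j → term χ j e₀ ≡ contribution j (toℤ₃ (χ e₀))
    term-e₀ χ j rewrite ⌊⌋-false (eInC? e₀) e₀∉C | ψ-chord χ = refl

    D-change : ∀ S S' → Update (inj₂ e₀) S S' → ∀ j → let δ = switch (S' (inj₂ e₀)) 1₃ in
      D (S' ∘ inj₂) j ≡ D (S ∘ inj₂) j +₃ (at-e₀ j h0 δ +₃ at-e₀ j h1 δ)
    D-change S S' (same , plus-at-e₀) j = begin
      D χ' j
        ≡⟨ sum₃-change (m G) (term χ' j) (term χ j) e₀ off ⟩
      D χ j +₃ (term χ' j e₀ -₃ term χ j e₀)
        ≡⟨ cong (D χ j +₃_) (cong₂ _-₃_ (term-e₀ χ' j) e₀-before) ⟩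
      D χ j +₃ (contribution j (toℤ₃ α) -₃ contribution j 1₃)
        ≡⟨ cong (D χ j +₃_) (difference (at e₀ h0 (vs C j) ∧ true , at e₀ h1 (vs C j) ∧ true ,
                                         τ e₀ h0 , τ e₀ h1 , α)) ⟩
      D χ j +₃ (at-e₀ j h0 (switch α 1₃) +₃ at-e₀ j h1 (switch α 1₃))  ∎
      where
      open ≡-Reasoning
      α = S' (inj₂ e₀)
      χ χ' : Fin (m G) → Sign
      χ = S ∘ inj₂
      χ' = S' ∘ inj₂
      e₀-before : term χ j e₀ ≡ contribution j 1₃
      e₀-before = trans (term-e₀ χ j) (cong (contribution j ∘ toℤ₃) plus-at-e₀)
      off : ∀ e → e ≢ e₀ → term χ' j e ≡ term χ j e
      off e e≢e₀ = Sℤ₃.∑-cong 2 λ i →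
        cong (λ y → if at e i (vs C j) ∧ not (isC e) then sg (τ e i) y else 0₃)
             (ψ-cong {χ} {χ'} e (same (inj₂ e) λ { refl → e≢e₀ refl }))
      difference = by-exhaustion λ (c₀ , c₁ , τ₀ , τ₁ , α) →
        ((if c₀ then sg τ₀ (toℤ₃ α) else 0₃) +₃ ((if c₁ then sg τ₁ (toℤ₃ α) else 0₃) +₃ 0₃))
          -₃ ((if c₀ then sg τ₀ 1₃ else 0₃) +₃ ((if c₁ then sg τ₁ 1₃ else 0₃) +₃ 0₃))
        ≟ (if c₀ then sg τ₀ (switch α 1₃) else 0₃) +₃ (if c₁ then sg τ₁ (switch α 1₃) else 0₃)

    single-end : ∀ i w → vs C w ≡ end G e₀ i → ∀ y →
      sum₃ (suc k) (λ j → -₃ sg (ω j) (at-e₀ j i y)) ≡ -₃ sg (ω w) (sg (τ e₀ i) y)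
    single-end i w pw y = trans (Sℤ₃.∑-single (suc k) (λ j → -₃ sg (ω j) (at-e₀ j i y)) w off)
      (cong (λ b → -₃ sg (ω w) (if b then sg (τ e₀ i) y else 0₃))
            (trans (∧-identityʳ _) (⌊⌋-true (end G e₀ i ≟F vs C w) (sym pw))))
      where
      vanish = by-exhaustion λ s → -₃ sg s 0₃ ≟ 0₃
      off : ∀ j → j ≢ w → -₃ sg (ω j) (at-e₀ j i y) ≡ 0₃
      off j j≢w = trans (cong (λ b → -₃ sg (ω j) (if b then sg (τ e₀ i) y else 0₃))
                              (trans (∧-identityʳ _) (⌊⌋-false (end G e₀ i ≟F vs C j)
                                 λ q → j≢w (sym (vs-inj C w j (trans pw q))))))
                        (vanish (ω j))

    change-chord : ∀ S S' → Update (inj₂ e₀) S S' →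
      Φ S' ≡ Φ S +₃ switch (S' (inj₂ e₀)) chordWeight
    change-chord S S' update@(same , _) = begin
      Φ S'                                            ≡⟨ Sℤ₃.∑-cong (suc k) pointwise ⟩
      sum₃ (suc k) (λ j → g j +₃ (A j +₃ B j))        ≡⟨ Sℤ₃.∑-∙ (suc k) g (λ j → A j +₃ B j) ⟩
      Φ S +₃ sum₃ (suc k) (λ j → A j +₃ B j)          ≡⟨ cong (Φ S +₃_) (Sℤ₃.∑-∙ (suc k) A B) ⟩
      Φ S +₃ (sum₃ (suc k) A +₃ sum₃ (suc k) B)
        ≡⟨ cong (Φ S +₃_) (cong₂ _+₃_ (single-end h0 u pu δ) (single-end h1 v pv δ)) ⟩
      Φ S +₃ ((-₃ sg (ω u) (sg (τ e₀ h0) δ)) +₃ (-₃ sg (ω v) (sg (τ e₀ h1) δ)))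
        ≡⟨ cong (Φ S +₃_) (weights (ω u , τ e₀ h0 , ω v , τ e₀ h1 , α)) ⟩
      Φ S +₃ switch α chordWeight                      ∎
      where
      open ≡-Reasoning
      α = S' (inj₂ e₀)
      δ = switch α 1₃
      g A B : Fin (suc k) → ℤ₃
      g j = sg (ω j) (rhs (S ∘ inj₁) (S ∘ inj₂) j)
      A j = -₃ sg (ω j) (at-e₀ j h0 δ)
      B j = -₃ sg (ω j) (at-e₀ j h1 δ)
      expand = by-exhaustion λ (w , T , d , x , y) →
        sg w (T -₃ (d +₃ (x +₃ y))) ≟ sg w (T -₃ d) +₃ ((-₃ sg w x) +₃ (-₃ sg w y))
      weights = by-exhaustion λ (ωu , τ₀ , ωv , τ₁ , α) →
        (-₃ sg ωu (sg τ₀ (switch α 1₃))) +₃ (-₃ sg ωv (sg τ₁ (switch α 1₃)))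
          ≟ switch α (-₃ (toℤ₃ (ωu · τ₀) +₃ toℤ₃ (ωv · τ₁)))
      pointwise : ∀ j → sg (ω j) (rhs (S' ∘ inj₁) (S' ∘ inj₂) j) ≡ g j +₃ (A j +₃ B j)
      pointwise j = trans (cong₂ (λ α d → sg (ω j) (target (deg G (vs C j)) α -₃ d))
                                 (same (inj₁ j) λ ()) (D-change S S' update j))
                          (expand (ω j , target (deg G (vs C j)) (S (inj₁ j)) , D (S ∘ inj₂) j , _ , _))

  -- When C is balanced its signature is the coboundary of the potential ω,
  -- extended by plus to the vertices off C.  A chord in 𝒰(C) therefore has
  -- nonzero weight: otherwise its sign would be a coboundary too, and the
  -- unbalanced cycle of C ∪ e₀ would be balanced.
  module Balanced (balanced : cycleSign ≡ plus) where

    ω-coboundary : ∀ l → σ' l ≡ ω l · ω (next G l)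
    ω-coboundary l with position l
    ... | inner i = trans (sym (xxy (ω (inject₁ i) , σ' (inject₁ i))))
                          (cong (ω (inject₁ i) ·_) (sym (trans (cong ω (next-inject₁ G i)) (ω-step i))))
      where xxy = by-exhaustion λ (x , y) → x · (x · y) ≟ y
    ... | last = trans (closing (ω (fromℕ k) , σ' (fromℕ k)) (trans (sym cycleSign-ω) balanced))
                       (cong (ω (fromℕ k) ·_) (sym (cong ω (next-last G k))))
      where closing = by-exhaustion λ (x , y) → (x · y ≟ plus) →-dec (y ≟ x · plus)

    Ω : Fin (n G) → Sign
    Ω w with any? (λ j → vs C j ≟F w)
    ... | yes (j , _) = ω j
    ... | no _        = plus

    Ω-vs : ∀ j → Ω (vs C j) ≡ ω j
    Ω-vs j with any? (λ i → vs C i ≟F vs C j)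
    ... | yes (i , q) = cong ω (vs-inj C i j q)
    ... | no ∉        = ⊥-elim (∉ (j , refl))

    cycle-coboundary : ∀ l → σ G (es C l) ≡ Ω (end G (es C l) h0) · Ω (end G (es C l) h1)
    cycle-coboundary l = trans (σ-cycle l) (trans (ω-coboundary l)
      (sym (trans (ends-product (joins C l) Ω) (cong₂ _·_ (Ω-vs l) (Ω-vs (next G l))))))

    chordWeight-nonzero : ∀ e₀ e₀∉C u v pu pv (Dc : Cycle G) →
      (∀ j → eInC G C (es Dc j) ⊎ es Dc j ≡ e₀) → UnbalancedC G Dc →
      ChordChange.chordWeight e₀ e₀∉C u v pu pv ≢ 0₃
    chordWeight-nonzero e₀ e₀∉C u v pu pv Dc inside unbalanced weight≡0 =
      plus≢minus (trans (sym (coboundary-balanced Ω Dc coboundary)) unbalanced)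
      where
      sign-from-weight = by-exhaustion λ (ωu , τ₀ , ωv , τ₁ , σ) →
        (τ₀ · τ₁ ≟ negS σ) →-dec
        ((-₃ (toℤ₃ (ωu · τ₀) +₃ toℤ₃ (ωv · τ₁)) ≟ 0₃) →-dec (σ ≟ ωu · ωv))
      Coboundary : Fin (m G) → Set
      Coboundary f = σ G f ≡ Ω (end G f h0) · Ω (end G f h1)
      σ-e₀ : Coboundary e₀
      σ-e₀ = trans (sign-from-weight (ω u , τ e₀ h0 , ω v , τ e₀ h1 , σ G e₀) (isO e₀) weight≡0)
        (sym (cong₂ _·_ (trans (cong Ω (sym pu)) (Ω-vs u)) (trans (cong Ω (sym pv)) (Ω-vs v))))
      coboundary : ∀ j → Coboundary (es Dc j)
      coboundary j with inside j
      ... | inj₁ (l , q) = subst Coboundary q (cycle-coboundary l)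
      ... | inj₂ q       = subst Coboundary (sym q) σ-e₀

    counted-change : ∀ z → Counted G C z →
      Σ ℤ₃ λ E → E ≢ 0₃ × (∀ S S' → Update z S S' → Φ S' ≡ Φ S +₃ switch (S' z) E)
    counted-change (inj₁ i) deg≡2 = toℤ₃ (ω i) , sg-nonzero (ω i) 1₃ (λ ()) , change-vertex i deg≡2
    counted-change (inj₂ e₀) (e₀∉C , (u , pu) , (v , pv) , _ , Dc , inside , unbalanced) =
      chordWeight , chordWeight-nonzero e₀ e₀∉C u v pu pv Dc inside unbalanced , change-chord
      where open ChordChange e₀ e₀∉C u v pu pv

    balanced-choice : ∀ x y → x ≢ y → Counted G C x → Counted G C y →
      Σ (Item → Sign) λ S → Φ S ≡ 0₃
    balanced-choice x y x≢y counted-x counted-y = S₂ , (begin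
      Φ S₂                                       ≡⟨ change-y S₁ S₂ (updates y β S₁ S₁-at-y) ⟩
      Φ S₁ +₃ switch (S₂ y) Ey                   ≡⟨ cong₂ (λ p q → p +₃ switch q Ey)
                                                      (change-x S₀ S₁ (updates x α S₀ refl)) (update-at y β S₁) ⟩
      (Φ S₀ +₃ switch (S₁ x) Ex) +₃ switch β Ey  ≡⟨ cong (λ q → (Φ S₀ +₃ switch q Ex) +₃ switch β Ey)
                                                      (update-at x α S₀) ⟩
      (Φ S₀ +₃ switch α Ex) +₃ switch β Ey       ≡⟨ proj₂ chosen ⟩
      0₃                                         ∎)
      where
      open ≡-Reasoning
      Ex Ey : ℤ₃
      Ex = proj₁ (counted-change x counted-x)
      Ey = proj₁ (counted-change y counted-y)
      change-x = proj₂ (proj₂ (counted-change x counted-x))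
      change-y = proj₂ (proj₂ (counted-change y counted-y))
      S₀ S₁ S₂ : Item → Sign
      S₀ _ = plus
      chosen = pick (Φ S₀) Ex Ey (proj₁ (proj₂ (counted-change x counted-x)))
                                 (proj₁ (proj₂ (counted-change y counted-y)))
      α = proj₁ (proj₁ chosen)
      β = proj₂ (proj₁ chosen)
      S₁ = update x α S₀
      S₂ = update y β S₁
      S₁-at-y : S₁ y ≡ plus
      S₁-at-y = update-off x α S₀ y (x≢y ∘ sym)

  choice : Removable G C → Σ (Item → Sign) λ S → cycleSign ≡ plus → Φ S ≡ 0₃
  choice removable = by-sign cycleSign refl removable
    where
    by-sign : ∀ s → cycleSign ≡ s → Removable G C →
      Σ (Item → Sign) λ S → cycleSign ≡ plus → Φ S ≡ 0₃
    by-sign minus c _ = (λ _ → plus) , λ p → ⊥-elim (plus≢minus (trans (sym p) c))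
    by-sign plus c (inj₁ unbalanced) =
      ⊥-elim (plus≢minus (trans (sym c) (trans (sym signC≡cycleSign) unbalanced)))
    by-sign plus c (inj₂ (x , y , x≢y , counted-x , counted-y)) =
      proj₁ chosen , λ _ → proj₂ chosen
      where chosen = Balanced.balanced-choice c x y x≢y counted-x counted-y

lemma6p1 : (G : SignedGraph) → IsShrubbery G →
    (τ : Fin (m G) → Fin 2 → Sign) → IsOrientation G τ →
    (C : Cycle G) → Removable G C →
    (φ' : Fin (m G) → Γ) →
    IsWateringIn G (outside G C) τ φ' → NowhereZeroIn G (outside G C) φ' →
    Σ (Fin (m G) → Γ) λ φ →
      IsWatering G τ φ × NowhereZero G φ
      × (∀ e → inS G (outside G C) e ≡ true → φ e ≡ φ' e)
      × (∀ e → (proj₁ (φ e) ≢ 0₂) ⇔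
           (eInC G C e ⊎ (inS G (outside G C) e ≡ true × proj₁ (φ' e) ≢ 0₂)))
lemma6p1 G _ τ isO C removable φ' wφ' nzφ' = φ x χ , extension ε χ x solves
  where
  open Construction G τ isO C φ' wφ' nzφ'
  S = proj₁ (choice removable)
  ε = S ∘ inj₁
  χ = S ∘ inj₂
  solution = solve (rhs ε χ) (proj₂ (choice removable))
  x = proj₁ solution
  solves = proj₂ solution
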